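{- Let $k$-R, $k$-N and $\infty$-R denote respectively the sets of $k$-regular, $k$-normal and $\infty$-regular subrows of the Kolakoski sequence $S$. Then: 1. If $k\ge h$ then $k$-R $\subseteq$ $h$-R. 2. For every non-negative integer $k$, $k$-N $\subset$ $k$-R. 3. If $k\ne h$ then $k$-N $\cap$ $h$-N $=\emptyset$. 4. For every non-negative integer $k$, if $w\in k$-N then $w\notin\infty$-R. 5. For positive integers $a<b<c$, if $S_{a,b}\in k$-R and $S_{b+1,c}\in k$-R, then $S_{a,c}\in k$-R. 6. For positive integers $a<b<c$, if $S_{a,b}\in k$-N and $S_{b+1,c}\in k$-N, then $S_{a,c}\in (k+1)$-R.
   Context: Words are over the alphabet $\{1,2\}$; $|v|$ is the length of $v$. For a finite or infinite word $v=a_1a_2\cdots$, its integral $v^{ -1}$ is obtained by replacing each letter $a_i$ by $a_i$ copies of the letter $1$ if $i$ is odd and by $a_i$ copies of the letter $2$ if $i$ is even. The Kolakoski sequence $S=s_1s_2\cdots=1221121221\cdots$ is the unique infinite word over $\{1,2\}$ with $S^{ -1}=S$. For $1\le a\le b$ write $S_{a,b}=s_a\cdots s_b$; a subrow of $S$ is such an occurrence (word together with its starting position). The $S$-integral of the subrow $w=S_{a,b}$ is the subrow $w_S^{ -1}:=S_{|u^{ -1}|+1,\;|u^{ -1}|+|w^{ -1}|}$, where $u=s_1\cdots s_{a-1}$ (empty if $a=1$); iterate: $w_S^{0}=w$, $w_S^{ -n}=(w_S^{ -(n-1)})_S^{ -1}$. A subrow $w$ is $k$-regular if $|w_S^{ -h}|$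 is even for all $0\le h\le k$; $k$-normal if it is $k$-regular but not $(k+1)$-regular; $\infty$-regular if it is $k$-regular for every $k\ge 0$. -}

module Defs where

open import Data.Nat using (ℕ; zero; suc; _+_; _∸_; _≤_; _<_)
open import Data.Nat.Properties using ()
open import Data.Nat.Base using (_%_)
open import Data.Bool using (Bool; true; false; not; if_then_else_)
open import Data.List using (List; []; _∷_; _++_; replicate; map; upTo; sum; length; drop; head)
open import Data.Maybe using (fromMaybe)
open import Data.Product using (_×_; _,_; proj₁; proj₂)
open import Data.Nat.Properties using ()
open import Relation.Nullary using (¬_)
open import Relation.Binary.PropositionalEquality using (_≡_)
open import Function using (_∘_)

expand : Bool → List ℕ → List ℕ
expand odd []       = []
expand odd (x ∷ xs) = replicate x (if odd then 1 else 2) ++ expand (not odd) xs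

integralWord : List ℕ → List ℕ
integralWord = expand true

-- Prefixes of the Kolakoski sequence: start from 122 and integrate.
-- Since S⁻¹ = S, the integral of a prefix is again a prefix, and the
-- n-th iterate has length ≥ n + 3.
kolPrefix : ℕ → List ℕ
kolPrefix zero    = 1 ∷ 2 ∷ 2 ∷ []
kolPrefix (suc n) = integralWord (kolPrefix n)

-- The Kolakoski sequence, 1-indexed: s n = s_n  (s 0 is a dummy value).
s : ℕ → ℕ
s zero    = 1
s (suc n) = fromMaybe 1 (head (drop n (kolPrefix (suc n))))

-- Subrows.  A subrow S_{a,b} is represented by its pair of positions
-- (a , b), valid when 1 ≤ a ≤ b.

Subrow : Set
Subrow = ℕ × ℕ

Valid : Subrow → Set
Valid (a , b) = 1 ≤ a × a ≤ b

-- the word s_a ⋯ s_b (empty if b < a)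
word : ℕ → ℕ → List ℕ
word a b = map (λ i → s (a + i)) (upTo (suc b ∸ a))

len : Subrow → ℕ
len (a , b) = length (word a b)

integralS : Subrow → Subrow
integralS (a , b) =
  let U = length (integralWord (word 1 (a ∸ 1)))
      W = length (integralWord (word a b))
  in (U + 1 , U + W)

integralS^ : ℕ → Subrow → Subrow
integralS^ zero    w = w
integralS^ (suc n) w = integralS (integralS^ n w)

Even : ℕ → Set
Even n = n % 2 ≡ 0

Regular : ℕ → Subrow → Set
Regular k w = ∀ h → h ≤ k → Even (len (integralS^ h w))

Normal : ℕ → Subrow → Set
Normal k w = Regular k w × ¬ Regular (suc k) w

InfRegular : Subrow → Set
InfRegular w = ∀ k → Regular k w

{-# OPTIONS --safe #-}
-- With P n = s₁ + ⋯ + sₙ, the S-integral of S_{m+1,n} is S_{P m + 1, P n}, so the h-th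
-- S-integral of S_{m+1,n} has length Pʰ n ∸ Pʰ m (here Pʰ m is fold m prefixSum h).
-- These lengths add up over adjacent subrows, so two even or two odd lengths give an even one.
module Submission where

open import Defs
open import Data.Nat using (ℕ; zero; suc; _+_; _∸_; _≤_; _<_; _%_; s≤s)
open import Data.Nat.Properties
open import Data.Nat.DivMod using (%-distribˡ-+; m%n<n)
open import Data.Nat.GeneralisedArithmetic using (fold)
open import Data.Nat.ListAction using (sum)
open import Data.Nat.ListAction.Properties using (sum-++)
open import Data.List using ([]; _∷_; _++_; replicate; map; applyUpTo; upTo; length)
open import Data.List.Properties using (length-++; length-replicate; map-upTo; length-upTo; length-map)
open import Data.Bool using (not)
open import Data.Product using (_×_; _,_; proj₁)
open import Data.Sum using (inj₁; inj₂)
open import Function using (_∘_)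
open import Relation.Nullary using (¬_; contradiction)
open import Relation.Binary.PropositionalEquality
open import Relation.Binary.Definitions using (tri<; tri≈; tri>)

private
  variable
    A : Set
    h k l m n : ℕ
    w : Subrow

¬Even⇒%2≡1 : ∀ n → ¬ Even n → n % 2 ≡ 1
¬Even⇒%2≡1 n ¬even with n % 2 | m%n<n n 2
... | zero        | _                 = contradiction refl ¬even
... | suc zero    | _                 = refl
... | suc (suc _) | s≤s (s≤s ())

Even-+ : m % 2 ≡ n % 2 → Even (m + n)
Even-+ {m} {n} m≡n = begin
  (m + n) % 2             ≡⟨ %-distribˡ-+ m n 2 ⟩
  (m % 2 + n % 2) % 2     ≡⟨ cong (λ r → (r + n % 2) % 2) m≡n ⟩
  (n % 2 + n % 2) % 2     ≡⟨ double%2 (n % 2) (m%n<n n 2) ⟩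
  0                       ∎
  where
  open ≡-Reasoning
  double%2 : ∀ r → r < 2 → (r + r) % 2 ≡ 0
  double%2 zero       _ = refl
  double%2 (suc zero) _ = refl
  double%2 (suc (suc _)) (s≤s (s≤s ()))

Regular-antitone : h ≤ k → Regular k w → Regular h w
Regular-antitone h≤k reg i i≤h = reg i (≤-trans i≤h h≤k)

Regular-suc : Regular k w → Even (len (integralS^ (suc k) w)) → Regular (suc k) w
Regular-suc reg even h h≤1+k with m≤n⇒m<n∨m≡n h≤1+k
... | inj₁ (s≤s h≤k) = reg h h≤k
... | inj₂ refl      = even

Normal⇒odd : ∀ w → Normal k w → len (integralS^ (suc k) w) % 2 ≡ 1
Normal⇒odd {k} w (reg , ¬reg) =
  ¬Even⇒%2≡1 (len (integralS^ (suc k) w)) (¬reg ∘ Regular-suc {k} {w} reg)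

Normal-unique : Normal k w → Normal h w → k ≡ h
Normal-unique {k = k} {h = h} (regk , ¬regk) (regh , ¬regh) with <-cmp k h
... | tri< k<h _ _ = contradiction (Regular-antitone k<h regh) ¬regk
... | tri≈ _ k≡h _ = k≡h
... | tri> _ _ h<k = contradiction (Regular-antitone h<k regk) ¬regh

Normal⇒¬InfRegular : Normal k w → ¬ InfRegular w
Normal⇒¬InfRegular {k} (_ , ¬reg) inf = ¬reg (inf (suc k))

length-expand : ∀ b xs → length (expand b xs) ≡ sum xs
length-expand b []       = refl
length-expand b (x ∷ xs) = trans (length-++ (replicate x _))
  (cong₂ _+_ (length-replicate x) (length-expand (not b) xs))

applyUpTo-+ : ∀ (f : ℕ → A) m n → applyUpTo f (m + n) ≡ applyUpTo f m ++ applyUpTo (f ∘ (m +_)) n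
applyUpTo-+ f zero    n = refl
applyUpTo-+ f (suc m) n = cong (f 0 ∷_) (applyUpTo-+ (f ∘ suc) m n)

word-++ : m ≤ n → word 1 m ++ word (suc m) n ≡ word 1 n
word-++ {m} {n} m≤n = begin
  word 1 m ++ word (suc m) n
    ≡⟨ cong₂ _++_ (map-upTo (s ∘ suc) m) (map-upTo (λ i → s (suc m + i)) (n ∸ m)) ⟩
  applyUpTo (s ∘ suc) m ++ applyUpTo (λ i → s (suc m + i)) (n ∸ m)
    ≡⟨ sym (applyUpTo-+ (s ∘ suc) m (n ∸ m)) ⟩
  applyUpTo (s ∘ suc) (m + (n ∸ m))
    ≡⟨ cong (applyUpTo (s ∘ suc)) (m+[n∸m]≡n m≤n) ⟩
  applyUpTo (s ∘ suc) n
    ≡⟨ sym (map-upTo (s ∘ suc) n) ⟩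
  word 1 n ∎
  where open ≡-Reasoning

prefixSum : ℕ → ℕ
prefixSum n = sum (word 1 n)

prefixSum-+ : m ≤ n → prefixSum m + sum (word (suc m) n) ≡ prefixSum n
prefixSum-+ {m} {n} m≤n = trans (sym (sum-++ (word 1 m) (word (suc m) n))) (cong sum (word-++ m≤n))

prefixSum-mono : m ≤ n → prefixSum m ≤ prefixSum n
prefixSum-mono {m} {n} m≤n = subst (prefixSum m ≤_) (prefixSum-+ m≤n) (m≤m+n _ _)

integralS-suc : m ≤ n → integralS (suc m , n) ≡ (suc (prefixSum m) , prefixSum n)
integralS-suc {m} {n} m≤n = cong₂ _,_
  (trans (+-comm _ 1) (cong suc (length-expand _ (word 1 m))))
  (trans (cong₂ _+_ (length-expand _ (word 1 m)) (length-expand _ (word (suc m) n))) (prefixSum-+ m≤n))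

prefixSum^-mono : ∀ h → m ≤ n → fold m prefixSum h ≤ fold n prefixSum h
prefixSum^-mono zero    m≤n = m≤n
prefixSum^-mono (suc h) m≤n = prefixSum-mono (prefixSum^-mono h m≤n)

integralS^-suc : ∀ h → m ≤ n →
  integralS^ h (suc m , n) ≡ (suc (fold m prefixSum h) , fold n prefixSum h)
integralS^-suc zero    m≤n = refl
integralS^-suc (suc h) m≤n =
  trans (cong integralS (integralS^-suc h m≤n)) (integralS-suc (prefixSum^-mono h m≤n))

len-suc : ∀ m n → len (suc m , n) ≡ n ∸ m
len-suc m n = trans (length-map _ (upTo (n ∸ m))) (length-upTo (n ∸ m))

len-integralS^ : ∀ h → m ≤ n → len (integralS^ h (suc m , n)) ≡ fold n prefixSum h ∸ fold m prefixSum h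
len-integralS^ {m} {n} h m≤n =
  trans (cong len (integralS^-suc h m≤n)) (len-suc (fold m prefixSum h) (fold n prefixSum h))

∸-split : l ≤ m → m ≤ n → n ∸ l ≡ (m ∸ l) + (n ∸ m)
∸-split {l} {m} {n} l≤m m≤n = trans (cong (_∸ l) (sym (m+[n∸m]≡n m≤n))) (+-∸-comm (n ∸ m) l≤m)

len-integralS^-++ : ∀ h → l ≤ m → m ≤ n →
  len (integralS^ h (suc l , n)) ≡ len (integralS^ h (suc l , m)) + len (integralS^ h (suc m , n))
len-integralS^-++ {l} {m} {n} h l≤m m≤n = begin
  len (integralS^ h (suc l , n))
    ≡⟨ len-integralS^ h (≤-trans l≤m m≤n) ⟩
  P n ∸ P l
    ≡⟨ ∸-split (prefixSum^-mono h l≤m) (prefixSum^-mono h m≤n) ⟩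
  (P m ∸ P l) + (P n ∸ P m)
    ≡⟨ sym (cong₂ _+_ (len-integralS^ h l≤m) (len-integralS^ h m≤n)) ⟩
  len (integralS^ h (suc l , m)) + len (integralS^ h (suc m , n)) ∎
  where
  open ≡-Reasoning
  P : ℕ → ℕ
  P x = fold x prefixSum h

Even-len-++ : ∀ h → l ≤ m → m ≤ n →
  len (integralS^ h (suc l , m)) % 2 ≡ len (integralS^ h (suc m , n)) % 2 →
  Even (len (integralS^ h (suc l , n)))
Even-len-++ h l≤m m≤n same =
  subst Even (sym (len-integralS^-++ h l≤m m≤n)) (Even-+ {len (integralS^ h _)} same)

Regular-++ : l ≤ m → m ≤ n → Regular k (suc l , m) → Regular k (suc m , n) → Regular k (suc l , n)
Regular-++ l≤m m≤n reg₁ reg₂ h h≤k =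
  Even-len-++ h l≤m m≤n (trans (reg₁ h h≤k) (sym (reg₂ h h≤k)))

Normal-++ : l ≤ m → m ≤ n → Normal k (suc l , m) → Normal k (suc m , n) → Regular (suc k) (suc l , n)
Normal-++ {k = k} l≤m m≤n nor₁ nor₂ =
  Regular-suc (Regular-++ l≤m m≤n (proj₁ nor₁) (proj₁ nor₂))
    (Even-len-++ (suc k) l≤m m≤n (trans (Normal⇒odd _ nor₁) (sym (Normal⇒odd _ nor₂))))

lemma3 : (∀ k h → h ≤ k → ∀ w → Valid w → Regular k w → Regular h w)
    × (∀ k w → Valid w → Normal k w → Regular k w)
    × (∀ k h → k ≢ h → ∀ w → Valid w → ¬ (Normal k w × Normal h w))
    × (∀ k w → Valid w → Normal k w → ¬ InfRegular w)
    × (∀ k a b c → 1 ≤ a → a < b → b < c →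
    Regular k (a , b) → Regular k (suc b , c) → Regular k (a , c))
    × (∀ k a b c → 1 ≤ a → a < b → b < c →
    Normal k (a , b) → Normal k (suc b , c) → Regular (suc k) (a , c))
lemma3 =
    (λ _ _ h≤k _ _ → Regular-antitone h≤k)
  , (λ _ _ _ → proj₁)
  , (λ _ _ k≢h _ _ (nor₁ , nor₂) → k≢h (Normal-unique nor₁ nor₂))
  , (λ _ _ _ → Normal⇒¬InfRegular)
  , (λ { _ (suc _) _ _ _ a<b b<c → Regular-++ (m+n≤o⇒n≤o 2 a<b) (<⇒≤ b<c) })
  , (λ { _ (suc _) _ _ _ a<b b<c → Normal-++ (m+n≤o⇒n≤o 2 a<b) (<⇒≤ b<c) })
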